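{- If $n\ge 2$ and $r\ge 1$ are integers, then $$\eta_{dl}(K_n\circ \overline{K_r}) = \left\lceil \frac{n+r}{r+1}\right\rceil\,.$$
   Context: For graphs $G$ with $V(G)=\{1,\dots,n\}$ and $H$, the corona $G\circ H$ is obtained from the disjoint union of $G$ and $n$ disjoint copies $H_1,\dots,H_n$ of $H$ by joining vertex $i\in V(G)$ by an edge to every vertex of $H_i$. $\overline{K_r}$ is the edgeless graph on $r$ vertices, so $K_n\circ\overline{K_r}$ is $K_n$ with $r$ pendant vertices attached to each vertex. For a graph $G$, $N(u)$ is the open neighborhood and $d_G(u)$ the degree of $u$. Given a vertex labeling $\ell: V(G)\to \mathbb{N}$ (positive integers), the $d$-lucky sum of $u$ is $d_\ell(u) = d_G(u) + \sum_{v\in N(u)}\ell(v)$; $\ell$ is a $d$-lucky labeling if $d_\ell(u)\neq d_\ell(v)$ for every edge $uv$. The $d$-lucky number $\eta_{dl}(G)$ is the least positive integer $k$ such that $G$ admits a $d$-lucky labeling $V(G)\to\{1,\dots,k\}$. -}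

module Defs where

open import Data.Nat using (ℕ; zero; suc; _+_; _≤_; _<_)
open import Data.Nat.DivMod using (_/_)
open import Data.Bool using (Bool; true; false; if_then_else_; _∧_; not)
open import Data.Fin using (Fin; _≟_)
open import Data.List using (List; map; _++_; concatMap; allFin)
open import Data.Nat.ListAction using (sum)
open import Relation.Binary.PropositionalEquality using (_≡_)
open import Data.Sum using (_⊎_; inj₁; inj₂)
open import Data.Product using (_×_; _,_; Σ; ∃)
open import Relation.Nullary using (¬_)
open import Relation.Nullary.Decidable using (⌊_⌋)

-- A finite graph presented by its vertex type, an explicit enumeration of
-- all vertices (each listed exactly once), and a Boolean adjacency relation.
record FinGraph : Set₁ where
  field
    V     : Set
    verts : List V
    adj   : V → V → Bool

open FinGraph public

degree : (G : FinGraph) → V G → ℕ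
degree G u = sum (map (λ v → if adj G u v then 1 else 0) (verts G))

nbrLabelSum : (G : FinGraph) → (V G → ℕ) → V G → ℕ
nbrLabelSum G ℓ u = sum (map (λ v → if adj G u v then ℓ v else 0) (verts G))

luckySum : (G : FinGraph) → (V G → ℕ) → V G → ℕ
luckySum G ℓ u = degree G u + nbrLabelSum G ℓ u

IsDLucky : (G : FinGraph) → (V G → ℕ) → Set
IsDLucky G ℓ = ∀ u v → adj G u v ≡ true → ¬ (luckySum G ℓ u ≡ luckySum G ℓ v)

HasDLuckyLabeling : FinGraph → ℕ → Set
HasDLuckyLabeling G k =
  Σ (V G → ℕ) λ ℓ → (∀ u → 1 ≤ ℓ u × ℓ u ≤ k) × IsDLucky G ℓ

DLuckyNumberIs : FinGraph → ℕ → Set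
DLuckyNumberIs G k =
  1 ≤ k × HasDLuckyLabeling G k × (∀ j → 1 ≤ j → j < k → ¬ HasDLuckyLabeling G j)

-- The corona K_n ∘ \overline{K_r}: vertices inj₁ i (i ∈ V(K_n)) and
-- inj₂ (i , j) (the j-th vertex of the copy H_i of \overline{K_r}).
private
  eqF : ∀ {n} → Fin n → Fin n → Bool
  eqF a b = ⌊ a ≟ b ⌋

coronaAdj : (n r : ℕ) → Fin n ⊎ (Fin n × Fin r) → Fin n ⊎ (Fin n × Fin r) → Bool
coronaAdj n r (inj₁ i) (inj₁ i′) = not (eqF i i′)
coronaAdj n r (inj₁ i) (inj₂ (i′ , _)) = eqF i i′
coronaAdj n r (inj₂ (i , _)) (inj₁ i′) = eqF i i′
coronaAdj n r (inj₂ _) (inj₂ _) = false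

KnCoronaEmpty : ℕ → ℕ → FinGraph
KnCoronaEmpty n r = record
  { V     = Fin n ⊎ (Fin n × Fin r)
  ; verts = map inj₁ (allFin n)
            ++ concatMap (λ i → map (λ j → inj₂ (i , j)) (allFin r)) (allFin n)
  ; adj   = coronaAdj n r
  }

⌈_/suc_⌉ : ℕ → ℕ → ℕ
⌈ a /suc b ⌉ = (a + b) / suc b

module Submission where

-- Write ℓ for a labelling with values in {1,…,k} and L for its d-lucky sums.
-- A pendant vertex (i,t) has L(i,t) = 1 + ℓ(i), while a clique vertex i has
-- L(i) = Σ_{x ≠ i} (1 + ℓ(x)) + Σ_t (1 + ℓ(i,t)) ≥ 2(n-1) + 2r, so as soon
-- as k ≤ n the clique sums never collide with pendant sums.  Moreover
--   L(i) + (k+1) = T + 2r + slack(i),   slack(i) = (k - ℓ(i)) + Σ_t (ℓ(i,t) - 1),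
-- where T does not depend on i.  Hence ℓ is d-lucky on the clique exactly when
-- slack is injective, and slack takes values in {0,…,(r+1)(k-1)}.
--   * Necessity: an injection Fin n → {0,…,(r+1)(k-1)} forces n ≤ 1 + (r+1)(k-1).
--   * Sufficiency: if n ≤ 1 + (r+1)(k-1), write the index i of a clique vertex
--     greedily as a sum of r+1 parts of size ≤ k-1 (one part per slot of the
--     slack) and read off a labelling with slack(i) = i.
-- The condition n ≤ 1 + (r+1)(k-1) is  n + r ≤ k(r+1), whose least solution k
-- is ⌈(n+r)/(r+1)⌉.

open import Defs
open import Data.Nat.Properties hiding (_≟_; suc-injective)
open import Algebra.Properties.CommutativeMonoid.Sum +-0-commutativeMonoid
  using (sum; sum-syntax; sum-cong-≗; ∑-distrib-+; sum-replicate-zero)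
open import Algebra.Properties.CommutativeSemigroup +-commutativeSemigroup
  using (interchange; xy∙z≈xz∙y)
open import Data.Bool using (Bool; true; false; if_then_else_; not)
open import Data.Bool.Properties using (T-≡; not-¬)
open import Data.Empty using (⊥-elim)
open import Data.Fin using (Fin; zero; suc; toℕ; fromℕ<)
open import Data.Fin.Properties using (_≟_; suc-injective; toℕ-injective; toℕ-fromℕ<; toℕ<n; injective⇒≤)
open import Data.List using (List; []; _∷_; map; _++_; concatMap; allFin; tabulate)
open import Data.List.Properties using (map-++; map-cong; map-∘; map-tabulate)
open import Data.Nat using (ℕ; zero; suc; _+_; _*_; _∸_; _⊓_; _≤_; _<_; z≤n; s≤s)
open import Data.Nat.DivMod using (_%_; m/n*n≤m; m≡m%n+[m/n]*n; m%n<n)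
open import Data.Nat.ListAction using () renaming (sum to listSum)
open import Data.Nat.ListAction.Properties using (sum-++)
open import Data.Nat.Tactic.RingSolver using (solve-∀)
open import Data.Product using (_×_; _,_; proj₁; proj₂)
open import Data.Sum using (_⊎_; inj₁; inj₂)
open import Function using (_∘_; id; _⇔_; mk⇔; Equivalence)
open import Relation.Binary.PropositionalEquality
open import Relation.Nullary using (¬_; yes; no)
open import Relation.Nullary.Decidable using (⌊_⌋; isYes≗does; dec-true; dec-false; ⌊⌋-map′; toWitness)

∑-const : ∀ n c → ∑[ i < n ] c ≡ n * c
∑-const zero    c = refl
∑-const (suc n) c = cong (c +_) (∑-const n c)

∑-mono-≤ : ∀ {n} {f g : Fin n → ℕ} → (∀ i → f i ≤ g i) → sum f ≤ sum g
∑-mono-≤ {zero}  f≤g = z≤n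
∑-mono-≤ {suc n} f≤g = +-mono-≤ (f≤g zero) (∑-mono-≤ (f≤g ∘ suc))

∑-guard : ∀ {n} (b : Bool) (g : Fin n → ℕ) →
  ∑[ x < n ] (if b then g x else 0) ≡ (if b then sum g else 0)
∑-guard     true  g = refl
∑-guard {n} false g = sum-replicate-zero n

⌊suc≟suc⌋ : ∀ {n} (i x : Fin n) → ⌊ suc i ≟ suc x ⌋ ≡ ⌊ i ≟ x ⌋
⌊suc≟suc⌋ i x = ⌊⌋-map′ (cong suc) suc-injective (i ≟ x)

∑-indicator : ∀ {n} (i : Fin n) (f : Fin n → ℕ) →
  ∑[ x < n ] (if ⌊ i ≟ x ⌋ then f x else 0) ≡ f i
∑-indicator {suc n} zero    f = trans (cong (f zero +_) (sum-replicate-zero n)) (+-identityʳ (f zero))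
∑-indicator {suc n} (suc i) f = begin
  ∑[ x < n ] (if ⌊ suc i ≟ suc x ⌋ then f (suc x) else 0)
    ≡⟨ sum-cong-≗ (λ x → cong (λ b → if b then f (suc x) else 0) (⌊suc≟suc⌋ i x)) ⟩
  ∑[ x < n ] (if ⌊ i ≟ x ⌋ then f (suc x) else 0)
    ≡⟨ ∑-indicator i (f ∘ suc) ⟩
  f (suc i)
    ∎
  where open ≡-Reasoning

∑-indicator-complement : ∀ {n} (i : Fin n) (f : Fin n → ℕ) →
  ∑[ x < n ] (if not ⌊ i ≟ x ⌋ then f x else 0) + f i ≡ sum f
∑-indicator-complement {suc n} zero    f = +-comm (sum (f ∘ suc)) (f zero)
∑-indicator-complement {suc n} (suc i) f = begin
  f zero + ∑[ x < n ] (if not ⌊ suc i ≟ suc x ⌋ then f (suc x) else 0) + f (suc i)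
    ≡⟨ +-assoc (f zero) _ (f (suc i)) ⟩
  f zero + (∑[ x < n ] (if not ⌊ suc i ≟ suc x ⌋ then f (suc x) else 0) + f (suc i))
    ≡⟨ cong (λ s → f zero + (s + f (suc i))) (sum-cong-≗ (λ x →
         cong (λ b → if not b then f (suc x) else 0) (⌊suc≟suc⌋ i x))) ⟩
  f zero + (∑[ x < n ] (if not ⌊ i ≟ x ⌋ then f (suc x) else 0) + f (suc i))
    ≡⟨ cong (f zero +_) (∑-indicator-complement i (f ∘ suc)) ⟩
  f zero + sum (f ∘ suc)
    ∎
  where open ≡-Reasoning

listSum-map-+ : ∀ {A : Set} (f g : A → ℕ) (xs : List A) →
  listSum (map f xs) + listSum (map g xs) ≡ listSum (map (λ x → f x + g x) xs)
listSum-map-+ f g []       = refl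
listSum-map-+ f g (x ∷ xs) =
  trans (interchange (f x) (listSum (map f xs)) (g x) (listSum (map g xs)))
        (cong (f x + g x +_) (listSum-map-+ f g xs))

listSum-allFin : ∀ n (f : Fin n → ℕ) → listSum (map f (allFin n)) ≡ sum f
listSum-allFin n f = trans (cong listSum (map-tabulate id f)) (listSum-tabulate f)
  where
  listSum-tabulate : ∀ {m} (g : Fin m → ℕ) → listSum (tabulate g) ≡ sum g
  listSum-tabulate {zero}  g = refl
  listSum-tabulate {suc m} g = cong (g zero +_) (listSum-tabulate (g ∘ suc))

listSum-concatMap : ∀ {A B : Set} (h : B → ℕ) (g : A → List B) (xs : List A) →
  listSum (map h (concatMap g xs)) ≡ listSum (map (λ x → listSum (map h (g x))) xs)
listSum-concatMap h g []       = refl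
listSum-concatMap h g (x ∷ xs) = begin
  listSum (map h (g x ++ concatMap g xs))
    ≡⟨ cong listSum (map-++ h (g x) (concatMap g xs)) ⟩
  listSum (map h (g x) ++ map h (concatMap g xs))
    ≡⟨ sum-++ (map h (g x)) (map h (concatMap g xs)) ⟩
  listSum (map h (g x)) + listSum (map h (concatMap g xs))
    ≡⟨ cong (listSum (map h (g x)) +_) (listSum-concatMap h g xs) ⟩
  listSum (map h (g x)) + listSum (map (λ y → listSum (map h (g y))) xs)
    ∎
  where open ≡-Reasoning

luckySum-weighted : (G : FinGraph) (ℓ : V G → ℕ) (u : V G) →
  luckySum G ℓ u ≡ listSum (map (λ v → if adj G u v then suc (ℓ v) else 0) (verts G))
luckySum-weighted G ℓ u =
  trans (listSum-map-+ (λ v → if adj G u v then 1 else 0) (λ v → if adj G u v then ℓ v else 0) (verts G))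
        (cong listSum (map-cong (λ v → merge (adj G u v) (ℓ v)) (verts G)))
  where
  merge : ∀ b a → (if b then 1 else 0) + (if b then a else 0) ≡ (if b then suc a else 0)
  merge true  a = refl
  merge false a = refl

Vertex : ℕ → ℕ → Set
Vertex n r = Fin n ⊎ (Fin n × Fin r)

listSum-corona : ∀ n r (h : Vertex n r → ℕ) →
  listSum (map h (verts (KnCoronaEmpty n r)))
    ≡ ∑[ x < n ] h (inj₁ x) + ∑[ x < n ] ∑[ t < r ] h (inj₂ (x , t))
listSum-corona n r h = begin
  listSum (map h (clique ++ pendants))
    ≡⟨ cong listSum (map-++ h clique pendants) ⟩
  listSum (map h clique ++ map h pendants)
    ≡⟨ sum-++ (map h clique) (map h pendants) ⟩
  listSum (map h clique) + listSum (map h pendants)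
    ≡⟨ cong₂ _+_ clique-sum pendant-sum ⟩
  ∑[ x < n ] h (inj₁ x) + ∑[ x < n ] ∑[ t < r ] h (inj₂ (x , t))
    ∎
  where
  open ≡-Reasoning
  clique : List (Vertex n r)
  clique = map inj₁ (allFin n)
  pendantsAt : Fin n → List (Vertex n r)
  pendantsAt x = map (λ t → inj₂ (x , t)) (allFin r)
  pendants : List (Vertex n r)
  pendants = concatMap pendantsAt (allFin n)
  clique-sum : listSum (map h clique) ≡ ∑[ x < n ] h (inj₁ x)
  clique-sum = trans (cong listSum (sym (map-∘ (allFin n)))) (listSum-allFin n (h ∘ inj₁))
  pendantsAt-sum : ∀ x → listSum (map h (pendantsAt x)) ≡ ∑[ t < r ] h (inj₂ (x , t))
  pendantsAt-sum x = trans (cong listSum (sym (map-∘ (allFin r)))) (listSum-allFin r _)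
  pendant-sum : listSum (map h pendants) ≡ ∑[ x < n ] ∑[ t < r ] h (inj₂ (x , t))
  pendant-sum = trans (listSum-concatMap h pendantsAt (allFin n))
                (trans (listSum-allFin n _) (sum-cong-≗ pendantsAt-sum))

InRange : {A : Set} → ℕ → (A → ℕ) → Set
InRange k ℓ = ∀ u → 1 ≤ ℓ u × ℓ u ≤ k

module CoronaSums (n r : ℕ) (ℓ : Vertex n r → ℕ) where

  L : Vertex n r → ℕ
  L = luckySum (KnCoronaEmpty n r) ℓ

  clique-weight : ℕ
  clique-weight = ∑[ x < n ] suc (ℓ (inj₁ x))

  others-weight : Fin n → ℕ
  others-weight i = ∑[ x < n ] (if not ⌊ i ≟ x ⌋ then suc (ℓ (inj₁ x)) else 0)

  pendant-weight : Fin n → ℕ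
  pendant-weight i = ∑[ t < r ] suc (ℓ (inj₂ (i , t)))

  private
    weight : Vertex n r → Vertex n r → ℕ
    weight u v = if coronaAdj n r u v then suc (ℓ v) else 0

    L-split : ∀ u → L u ≡ ∑[ x < n ] weight u (inj₁ x) + ∑[ x < n ] ∑[ t < r ] weight u (inj₂ (x , t))
    L-split u = trans (luckySum-weighted (KnCoronaEmpty n r) ℓ u) (listSum-corona n r (weight u))

  pendant-sum : ∀ i t → L (inj₂ (i , t)) ≡ suc (ℓ (inj₁ i))
  pendant-sum i t = begin
    L (inj₂ (i , t))
      ≡⟨ L-split (inj₂ (i , t)) ⟩
    ∑[ x < n ] (if ⌊ i ≟ x ⌋ then suc (ℓ (inj₁ x)) else 0) + ∑[ x < n ] ∑[ s < r ] 0
      ≡⟨ cong₂ _+_ (∑-indicator i (λ x → suc (ℓ (inj₁ x))))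
                   (trans (sum-cong-≗ {n} (λ x → sum-replicate-zero r)) (sum-replicate-zero n)) ⟩
    suc (ℓ (inj₁ i)) + 0
      ≡⟨ +-identityʳ _ ⟩
    suc (ℓ (inj₁ i))
      ∎
    where open ≡-Reasoning

  core-sum : ∀ i → L (inj₁ i) ≡ others-weight i + pendant-weight i
  core-sum i = begin
    L (inj₁ i)
      ≡⟨ L-split (inj₁ i) ⟩
    others-weight i + ∑[ x < n ] ∑[ t < r ] (if ⌊ i ≟ x ⌋ then suc (ℓ (inj₂ (x , t))) else 0)
      ≡⟨ cong (others-weight i +_) (sum-cong-≗ {n} (λ x → ∑-guard ⌊ i ≟ x ⌋ (λ t → suc (ℓ (inj₂ (x , t)))))) ⟩
    others-weight i + ∑[ x < n ] (if ⌊ i ≟ x ⌋ then pendant-weight x else 0)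
      ≡⟨ cong (others-weight i +_) (∑-indicator i pendant-weight) ⟩
    others-weight i + pendant-weight i
      ∎
    where open ≡-Reasoning

  core-sum-complement : ∀ i → L (inj₁ i) + suc (ℓ (inj₁ i)) ≡ clique-weight + pendant-weight i
  core-sum-complement i = begin
    L (inj₁ i) + suc (ℓ (inj₁ i))
      ≡⟨ cong (_+ suc (ℓ (inj₁ i))) (core-sum i) ⟩
    others-weight i + pendant-weight i + suc (ℓ (inj₁ i))
      ≡⟨ xy∙z≈xz∙y (others-weight i) (pendant-weight i) _ ⟩
    others-weight i + suc (ℓ (inj₁ i)) + pendant-weight i
      ≡⟨ cong (_+ pendant-weight i) (∑-indicator-complement i (λ x → suc (ℓ (inj₁ x)))) ⟩
    clique-weight + pendant-weight i
      ∎
    where open ≡-Reasoning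

  core-sum-lower : (∀ u → 1 ≤ ℓ u) → ∀ i → n * 2 + r * 2 ≤ L (inj₁ i) + 2
  core-sum-lower positive i = begin
    n * 2 + r * 2
      ≡⟨ sym (cong₂ _+_ (∑-const n 2) (∑-const r 2)) ⟩
    ∑[ x < n ] 2 + ∑[ t < r ] 2
      ≡⟨ cong (_+ ∑[ t < r ] 2) (sym (∑-indicator-complement i (λ _ → 2))) ⟩
    ∑[ x < n ] (if not ⌊ i ≟ x ⌋ then 2 else 0) + 2 + ∑[ t < r ] 2
      ≤⟨ +-mono-≤ (+-monoˡ-≤ 2 (∑-mono-≤ others≥2)) (∑-mono-≤ (λ t → s≤s (positive (inj₂ (i , t))))) ⟩
    others-weight i + 2 + pendant-weight i
      ≡⟨ xy∙z≈xz∙y (others-weight i) 2 (pendant-weight i) ⟩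
    others-weight i + pendant-weight i + 2
      ≡⟨ cong (_+ 2) (sym (core-sum i)) ⟩
    L (inj₁ i) + 2
      ∎
    where
    open ≤-Reasoning
    others≥2 : ∀ x → (if not ⌊ i ≟ x ⌋ then 2 else 0) ≤ (if not ⌊ i ≟ x ⌋ then suc (ℓ (inj₁ x)) else 0)
    others≥2 x with not ⌊ i ≟ x ⌋
    ... | true  = s≤s (positive (inj₁ x))
    ... | false = z≤n

  -- For labels in {1,…,k}: how far the weight around clique vertex i exceeds
  -- its least possible value, one term for i itself and one per pendant.
  slack : ℕ → Fin n → ℕ
  slack k i = (k ∸ ℓ (inj₁ i)) + ∑[ t < r ] (ℓ (inj₂ (i , t)) ∸ 1)

  core-sum-slack : ∀ k → InRange k ℓ → ∀ i →
    L (inj₁ i) + suc k ≡ (clique-weight + r * 2) + slack k i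
  core-sum-slack k range i = begin
    L (inj₁ i) + suc k
      ≡⟨ cong (λ m → L (inj₁ i) + suc m) (sym (m+[n∸m]≡n ℓᵢ≤k)) ⟩
    L (inj₁ i) + (suc ℓᵢ + (k ∸ ℓᵢ))
      ≡⟨ sym (+-assoc (L (inj₁ i)) (suc ℓᵢ) (k ∸ ℓᵢ)) ⟩
    L (inj₁ i) + suc ℓᵢ + (k ∸ ℓᵢ)
      ≡⟨ cong (_+ (k ∸ ℓᵢ)) (core-sum-complement i) ⟩
    clique-weight + pendant-weight i + (k ∸ ℓᵢ)
      ≡⟨ cong (λ p → clique-weight + p + (k ∸ ℓᵢ)) pendant-excess ⟩
    clique-weight + (r * 2 + excess) + (k ∸ ℓᵢ)
      ≡⟨ regroup clique-weight (r * 2) excess (k ∸ ℓᵢ) ⟩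
    clique-weight + r * 2 + ((k ∸ ℓᵢ) + excess)
      ∎
    where
    open ≡-Reasoning
    ℓᵢ : ℕ
    ℓᵢ = ℓ (inj₁ i)
    ℓᵢ≤k : ℓᵢ ≤ k
    ℓᵢ≤k = proj₂ (range (inj₁ i))
    excess : ℕ
    excess = ∑[ t < r ] (ℓ (inj₂ (i , t)) ∸ 1)
    pendant-excess : pendant-weight i ≡ r * 2 + excess
    pendant-excess = begin
      pendant-weight i
        ≡⟨ sum-cong-≗ (λ t → cong suc (sym (m+[n∸m]≡n (proj₁ (range (inj₂ (i , t))))))) ⟩
      ∑[ t < r ] (2 + (ℓ (inj₂ (i , t)) ∸ 1))
        ≡⟨ ∑-distrib-+ (λ _ → 2) (λ t → ℓ (inj₂ (i , t)) ∸ 1) ⟩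
      ∑[ t < r ] 2 + excess
        ≡⟨ cong (_+ excess) (∑-const r 2) ⟩
      r * 2 + excess
        ∎
    regroup : ∀ a b c d → a + (b + c) + d ≡ a + b + (d + c)
    regroup = solve-∀

  slack-eq⇒core-sum-eq : ∀ k → InRange k ℓ → ∀ i j →
    slack k i ≡ slack k j → L (inj₁ i) ≡ L (inj₁ j)
  slack-eq⇒core-sum-eq k range i j eq = +-cancelʳ-≡ (suc k) _ _
    (trans (core-sum-slack k range i)
      (trans (cong (clique-weight + r * 2 +_) eq) (sym (core-sum-slack k range j))))

  core-sum-eq⇒slack-eq : ∀ k → InRange k ℓ → ∀ i j →
    L (inj₁ i) ≡ L (inj₁ j) → slack k i ≡ slack k j
  core-sum-eq⇒slack-eq k range i j eq = +-cancelˡ-≡ (clique-weight + r * 2) _ _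
    (trans (sym (core-sum-slack k range i))
      (trans (cong (_+ suc k) eq) (core-sum-slack k range j)))

  slack-bound : ∀ K → InRange (suc K) ℓ → ∀ i → slack (suc K) i ≤ suc r * K
  slack-bound K range i = +-mono-≤
    (∸-monoʳ-≤ (suc K) (proj₁ (range (inj₁ i))))
    (≤-trans (∑-mono-≤ (λ t → ∸-monoˡ-≤ 1 (proj₂ (range (inj₂ (i , t))))))
             (≤-reflexive (∑-const r K)))

injection-bound : ∀ {n m} (f : Fin n → ℕ) → (∀ i → f i ≤ m) →
  (∀ i j → f i ≡ f j → i ≡ j) → n ≤ suc m
injection-bound f f≤m f-injective = injective⇒≤ {f = f′} f′-injective
  where
  f′ : Fin _ → Fin _
  f′ i = fromℕ< (s≤s (f≤m i))
  f′-injective : ∀ {i j} → f′ i ≡ f′ j → i ≡ j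
  f′-injective {i} {j} eq = f-injective i j
    (trans (sym (toℕ-fromℕ< (s≤s (f≤m i)))) (trans (cong toℕ eq) (toℕ-fromℕ< (s≤s (f≤m j)))))

clique-adjacent : ∀ {n r} {i j : Fin n} → ¬ i ≡ j → coronaAdj n r (inj₁ i) (inj₁ j) ≡ true
clique-adjacent {i = i} {j} i≢j = cong not (trans (isYes≗does (i ≟ j)) (dec-false (i ≟ j) i≢j))

-- Necessity: a d-lucky labelling with labels ≤ K+1 has an injective slack,
-- so the clique has at most (r+1)K + 1 vertices.
labelling⇒bound : ∀ n r K → HasDLuckyLabeling (KnCoronaEmpty n r) (suc K) → n ≤ suc (suc r * K)
labelling⇒bound n r K (ℓ , range , lucky) =
  injection-bound (slack (suc K)) (slack-bound K range) slack-injective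
  where
  open CoronaSums n r ℓ
  slack-injective : ∀ i j → slack (suc K) i ≡ slack (suc K) j → i ≡ j
  slack-injective i j eq with i ≟ j
  ... | yes i≡j = i≡j
  ... | no  i≢j = ⊥-elim (lucky (inj₁ i) (inj₁ j) (clique-adjacent {r = r} i≢j)
                                 (slack-eq⇒core-sum-eq (suc K) range i j eq))

-- Greedily pouring m units into bins of capacity K, bin t receives fill K m t.
fill : ℕ → ℕ → ℕ → ℕ
fill K m t = K ⊓ (m ∸ t * K)

⊓-greedy-step : ∀ K a B → K ⊓ a + (a ∸ K) ⊓ B ≡ a ⊓ (K + B)
⊓-greedy-step K a B with ≤-total a K
... | inj₁ a≤K rewrite m≥n⇒m⊓n≡n a≤K | m≤n⇒m∸n≡0 a≤K =
  trans (+-identityʳ a) (sym (m≤n⇒m⊓n≡m (≤-trans a≤K (m≤m+n K B))))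
... | inj₂ K≤a rewrite m≤n⇒m⊓n≡m K≤a =
  trans (+-distribˡ-⊓ K (a ∸ K) B) (cong (_⊓ (K + B)) (m+[n∸m]≡n K≤a))

fill-sum : ∀ K m s → ∑[ t < s ] fill K m (toℕ t) ≡ m ⊓ (s * K)
fill-sum K m zero    = sym (⊓-zeroʳ m)
fill-sum K m (suc s) = begin
  K ⊓ m + ∑[ t < s ] fill K m (suc (toℕ t))
    ≡⟨ cong (K ⊓ m +_) (sum-cong-≗ {s} (λ t → fill-shift (toℕ t))) ⟩
  K ⊓ m + ∑[ t < s ] fill K (m ∸ K) (toℕ t)
    ≡⟨ cong (K ⊓ m +_) (fill-sum K (m ∸ K) s) ⟩
  K ⊓ m + (m ∸ K) ⊓ (s * K)
    ≡⟨ ⊓-greedy-step K m (s * K) ⟩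
  m ⊓ (K + s * K)
    ∎
  where
  open ≡-Reasoning
  fill-shift : ∀ t → fill K m (suc t) ≡ fill K (m ∸ K) t
  fill-shift t = cong (K ⊓_) (sym (∸-+-assoc m K (t * K)))

-- A labelling with labels ≤ K+1 whose slack at clique vertex i is i itself:
-- i is poured greedily into r+1 bins of capacity K, the first bin giving the
-- deficit K+1 - ℓ(i) of the clique vertex and the others the excesses ℓ(i,t) - 1.
module GreedyLabelling (n r K : ℕ) where

  ℓ : Vertex n r → ℕ
  ℓ (inj₁ i)       = suc (K ∸ fill K (toℕ i) 0)
  ℓ (inj₂ (i , t)) = suc (fill K (toℕ i) (suc (toℕ t)))

  in-range : InRange (suc K) ℓ
  in-range (inj₁ i)       = s≤s z≤n , s≤s (m∸n≤m K (fill K (toℕ i) 0))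
  in-range (inj₂ (i , t)) = s≤s z≤n , s≤s (m⊓n≤m K (toℕ i ∸ suc (toℕ t) * K))

  open CoronaSums n r ℓ using (slack)

  slack-index : ∀ i → toℕ i ≤ suc r * K → slack (suc K) i ≡ toℕ i
  slack-index i i≤ = begin
    (K ∸ (K ∸ fill K m 0)) + ∑[ t < r ] fill K m (suc (toℕ t))
      ≡⟨ cong (_+ ∑[ t < r ] fill K m (suc (toℕ t))) (m∸[m∸n]≡n (m⊓n≤m K m)) ⟩
    ∑[ t < suc r ] fill K m (toℕ t)
      ≡⟨ fill-sum K m (suc r) ⟩
    m ⊓ (suc r * K)
      ≡⟨ m≤n⇒m⊓n≡m i≤ ⟩
    m
      ∎
    where
    open ≡-Reasoning
    m : ℕ
    m = toℕ i

clique-irreflexive : ∀ {n r} (i : Fin n) → coronaAdj n r (inj₁ i) (inj₁ i) ≡ false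
clique-irreflexive i = cong not (trans (isYes≗does (i ≟ i)) (dec-true (i ≟ i) refl))

⌊≟⌋-true⇒≡ : ∀ {n} (i j : Fin n) → ⌊ i ≟ j ⌋ ≡ true → i ≡ j
⌊≟⌋-true⇒≡ i j adj = toWitness {a? = i ≟ j} (Equivalence.from T-≡ adj)

separation : ∀ {n r c} → 2 ≤ n → 1 ≤ r → n * 2 + r * 2 ≤ c + 2 → suc n < c
separation {n} {r} {c} 2≤n 1≤r le = begin
  2 + n  ≤⟨ +-monoˡ-≤ n 2≤n ⟩
  n + n  ≡⟨ double n ⟩
  n * 2  ≤⟨ +-cancelʳ-≤ 2 (n * 2) c (≤-trans (+-monoʳ-≤ (n * 2) (*-monoˡ-≤ 2 1≤r)) le) ⟩
  c      ∎
  where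
  open ≤-Reasoning
  double : ∀ m → m + m ≡ m * 2
  double = solve-∀

-- Clique sums are separated by the slack, which is the vertex index, and
-- clique sums (≥ 2n) exceed pendant sums (≤ K+2 ≤ n+1).
bound⇒labelling : ∀ n r K → 2 ≤ n → 1 ≤ r → suc K ≤ n → n ≤ suc (suc r * K) →
  HasDLuckyLabeling (KnCoronaEmpty n r) (suc K)
bound⇒labelling n r K 2≤n 1≤r k≤n n≤ = ℓ , in-range , lucky
  where
  open GreedyLabelling n r K
  open CoronaSums n r ℓ

  core-injective : ∀ i j → L (inj₁ i) ≡ L (inj₁ j) → i ≡ j
  core-injective i j eq = toℕ-injective (begin
    toℕ i            ≡⟨ sym (slack-index i (index-bound i)) ⟩
    slack (suc K) i  ≡⟨ core-sum-eq⇒slack-eq (suc K) in-range i j eq ⟩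
    slack (suc K) j  ≡⟨ slack-index j (index-bound j) ⟩
    toℕ j            ∎)
    where
    open ≡-Reasoning
    index-bound : ∀ x → toℕ x ≤ suc r * K
    index-bound x = ≤-pred (≤-trans (toℕ<n x) n≤)

  pendant<core : ∀ i t → L (inj₂ (i , t)) < L (inj₁ i)
  pendant<core i t = begin-strict
    L (inj₂ (i , t))   ≡⟨ pendant-sum i t ⟩
    suc (ℓ (inj₁ i))   ≤⟨ s≤s (≤-trans (proj₂ (in-range (inj₁ i))) k≤n) ⟩
    suc n              <⟨ separation 2≤n 1≤r (core-sum-lower (proj₁ ∘ in-range) i) ⟩
    L (inj₁ i)         ∎
    where open ≤-Reasoning

  lucky : IsDLucky (KnCoronaEmpty n r) ℓ
  lucky (inj₁ i) (inj₁ j) adj eq with core-injective i j eq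
  ... | refl = not-¬ (clique-irreflexive {r = r} i) adj
  lucky (inj₁ i) (inj₂ (j , t)) adj eq with ⌊≟⌋-true⇒≡ i j adj
  ... | refl = >⇒≢ (pendant<core i t) eq
  lucky (inj₂ (i , t)) (inj₁ j) adj eq with ⌊≟⌋-true⇒≡ i j adj
  ... | refl = <⇒≢ (pendant<core i t) eq
  lucky (inj₂ _) (inj₂ _) () eq

⌈⌉-covers : ∀ a b → a ≤ ⌈ a /suc b ⌉ * suc b
⌈⌉-covers a b = +-cancelʳ-≤ b a (q * suc b) (begin
  a + b                        ≡⟨ m≡m%n+[m/n]*n (a + b) (suc b) ⟩
  (a + b) % suc b + q * suc b  ≤⟨ +-monoˡ-≤ (q * suc b) (≤-pred (m%n<n (a + b) (suc b))) ⟩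
  b + q * suc b                ≡⟨ +-comm b (q * suc b) ⟩
  q * suc b + b                ∎)
  where
  open ≤-Reasoning
  q : ℕ
  q = ⌈ a /suc b ⌉

⌈⌉-least : ∀ a b j → j < ⌈ a /suc b ⌉ → j * suc b < a
⌈⌉-least a b j j<q = +-cancelʳ-≤ b (suc (j * suc b)) a (begin
  suc (j * suc b) + b      ≡⟨ cong suc (+-comm (j * suc b) b) ⟩
  suc j * suc b            ≤⟨ *-monoˡ-≤ (suc b) j<q ⟩
  ⌈ a /suc b ⌉ * suc b     ≤⟨ m/n*n≤m (a + b) (suc b) ⟩
  a + b                    ∎)
  where open ≤-Reasoning

capacity-shift : ∀ n r K → (n ≤ suc (suc r * K)) ⇔ (n + r ≤ suc K * suc r)
capacity-shift n r K = mk⇔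
  (λ n≤ → ≤-trans (+-monoˡ-≤ r n≤) (≤-reflexive (sym (expand K r))))
  (λ n+r≤ → +-cancelʳ-≤ r n (suc (suc r * K)) (≤-trans n+r≤ (≤-reflexive (expand K r))))
  where
  expand : ∀ K r → suc K * suc r ≡ suc (suc r * K) + r
  expand = solve-∀

-- k = n is always large enough: n + r ≤ n(r+1) for n ≥ 1.
+≤*suc : ∀ {n} r → 1 ≤ n → n + r ≤ n * suc r
+≤*suc {suc m} r _ = begin
  suc m + r          ≤⟨ +-monoʳ-≤ (suc m) (m≤n*m r (suc m)) ⟩
  suc m + suc m * r  ≡⟨ sym (*-suc (suc m) r) ⟩
  suc m * suc r      ∎
  where open ≤-Reasoning

least-capacity⇒η : ∀ n r k → 2 ≤ n → 1 ≤ r →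
  n + r ≤ k * suc r → (∀ j → j < k → j * suc r < n + r) →
  DLuckyNumberIs (KnCoronaEmpty n r) k
least-capacity⇒η n r zero 2≤n _ covers _ with ≤-trans 2≤n (≤-trans (m≤m+n n r) covers)
... | ()
least-capacity⇒η n r (suc K) 2≤n 1≤r covers least =
  s≤s z≤n , bound⇒labelling n r K 2≤n 1≤r k≤n (Equivalence.from (capacity-shift n r K) covers) , no-smaller
  where
  k≤n : suc K ≤ n
  k≤n = ≮⇒≥ (λ n<k → <⇒≱ (least n n<k) (+≤*suc r (≤-trans (s≤s z≤n) 2≤n)))
  no-smaller : ∀ j → 1 ≤ j → j < suc K → ¬ HasDLuckyLabeling (KnCoronaEmpty n r) j
  no-smaller (suc J) _ j<k labelling =
    <⇒≱ (least (suc J) j<k) (Equivalence.to (capacity-shift n r J) (labelling⇒bound n r J labelling))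

theorem2p3 : (n r : ℕ) → 2 ≤ n → 1 ≤ r →
    DLuckyNumberIs (KnCoronaEmpty n r) ⌈ n + r /suc r ⌉
theorem2p3 n r 2≤n 1≤r =
  least-capacity⇒η n r ⌈ n + r /suc r ⌉ 2≤n 1≤r (⌈⌉-covers (n + r) r) (⌈⌉-least (n + r) r)
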